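{- Let $m\in\mathbb{N}$ and $k\geq 3$, let $G=C_{2m+2}$, and let $\mathcal{H}=(L,H)$ be a $k$-fold $C_{2m+2}$-twister of $G$, with the vertices of $G$ ordered cyclically $u_1,\dots,u_{2m+2}$ and $L(u_i)=\{(u_i,l):l\in[k]\}$ as in the definition of a twister. Let $\mathcal{I}$ be the set of $\mathcal{H}$-colorings of $G$; for $I\in\mathcal{I}$ and $i\in[2m+2]$ let $c_{I,i}$ be the second coordinate of the unique vertex of $I\cap L(u_i)$. Define $I_1\approx I_2$ if there is $j\in\mathbb{Z}_k$ with $(c_{I_1,i}-c_{I_2,i})\bmod k=j$ for all $i\in[2m+2]$. Then (i) each equivalence class of $\approx$ has exactly $k$ elements, and (ii) if $I_1\approx I_2$ and $I_1\neq I_2$, then $c_{I_1,i}\neq c_{I_2,i}$ for all $i\in[2m+2]$.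
   Context: A cover of a graph $G$ is a pair $\mathcal{H}=(L,H)$ with $H$ a graph and $L:V(G)\to\mathcal{P}(V(H))$ such that $\{L(v)\}$ partitions $V(H)$ into $|V(G)|$ parts, each $H[L(v)]$ is complete, edges of $H$ between distinct $L(u),L(v)$ occur only if $uv\in E(G)$, and for $uv\in E(G)$ these edges form a (possibly empty) matching; $k$-fold means all $|L(v)|=k$. Edges of $H$ between distinct parts are cross edges. An $\mathcal{H}$-coloring is an independent set $I$ of $H$ with $|I\cap L(v)|=1$ for all $v$. For $n\geq 2$, a $k$-fold $C_{2n}$-twister is a $k$-fold cover $\mathcal{H}=(L,H)$ of $C_{2n}$ for which one can order the vertices cyclically as $u_1,\dots,u_{2n}$ and write $L(u_i)=\{(u_i,l):l\in[k]\}$ so that the set of cross edges of $H$ is exactly $\{(u_i,l)(u_{i+1},l): l\in[k], i\in[2n-1]\}\cup\{(u_{2n},l)(u_1,(l\bmod k)+1): l\in[k]\}$. -}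

module Defs where

open import Data.Nat using (ℕ; zero; suc; _+_; _*_; _<_; NonZero)
open import Data.Fin using (Fin; toℕ)
open import Data.Integer using (ℤ; +_; _-_)
open import Data.Integer.DivMod using (_%ℕ_)
open import Data.Product using (Σ; _×_; _,_; proj₁; ∃-syntax)
open import Data.Sum using (_⊎_)
open import Relation.Binary.PropositionalEquality using (_≡_; _≢_)
open import Relation.Nullary using (¬_)

-- Number of vertices of the cycle G = C_{2m+2}.
-- Position p : Fin (len m) stands for the vertex u_{p+1}.
len : ℕ → ℕ
len m = 2 * m + 2

-- Vertices of the cover graph H: (u_{p+1} , l+1) is encoded as (p , l),
-- with p : Fin (2m+2), l : Fin k  (so the label l+1 ∈ [k]).
VH : ℕ → ℕ → Set
VH m k = Fin (len m) × Fin k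

-- Directed version of the cross edges of the k-fold C_{2m+2}-twister:
--  (u_i , l)(u_{i+1} , l)          for i ∈ [2m+1], l ∈ [k]
--  (u_{2m+2} , l)(u_1 , (l mod k) + 1)  for l ∈ [k]
-- In 0-based labels, (l mod k)+1 corresponds to: l0+1 if l0+1 < k, and 0 if l0+1 = k.
CrossArc : (m k : ℕ) → VH m k → VH m k → Set
CrossArc m k (p , a) (q , b) =
    (suc (toℕ p) ≡ toℕ q × toℕ a ≡ toℕ b)
  ⊎ (suc (toℕ p) ≡ len m × toℕ q ≡ 0
       × ((suc (toℕ a) < k × toℕ b ≡ suc (toℕ a)) ⊎ (suc (toℕ a) ≡ k × toℕ b ≡ 0)))

Adj : (m k : ℕ) → VH m k → VH m k → Set
Adj m k (p , a) (q , b) =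
    (p ≡ q × a ≢ b)
  ⊎ CrossArc m k (p , a) (q , b)
  ⊎ CrossArc m k (q , b) (p , a)

-- A set I ⊆ V(H) meeting every L(u_i) in exactly one vertex is given by the
-- function c with I ∩ L(u_i) = {(u_i , c i)}; it is an H-coloring iff I is
-- independent in H.
IsHColoring : (m k : ℕ) → (Fin (len m) → Fin k) → Set
IsHColoring m k c = ∀ p q → ¬ Adj m k (p , c p) (q , c q)

record HColoring (m k : ℕ) : Set where
  constructor hcol
  field
    col   : Fin (len m) → Fin k
    indep : IsHColoring m k col

open HColoring public

-- Equality of colorings as vertex sets of H (same vertex in every part).
SameColoring : ∀ {m k} → HColoring m k → HColoring m k → Set
SameColoring I J = ∀ p → col I p ≡ col J p

Equiv : ∀ {m} (k : ℕ) .{{_ : NonZero k}} → HColoring m k → HColoring m k → Set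
Equiv {m} k I₁ I₂ =
  ∃[ j ] (j < k × (∀ p → ((+ toℕ (col I₁ p)) - (+ toℕ (col I₂ p))) %ℕ k ≡ j))

-- Adding a constant to every label modulo k is an automorphism of the
-- twister: a cross edge either keeps its label or raises it by one modulo k,
-- and both relations survive a common shift. Hence rotating the labels of a
-- coloring I by any s gives again a coloring. Conversely, for labels in [0, k)
-- the residue (c_{I,i} − c_{J,i}) mod k equals j exactly when c_{J,i} is
-- c_{I,i} rotated by −j, so the class of I consists of its k rotations, and two
-- distinct rotations of I disagree at every vertex.
module Submission where

open import Data.Nat
open import Data.Nat.Properties
open import Data.Nat.DivMod
open import Data.Integer using (-_; _-_; _%ℕ_) renaming (+_ to ⁺_)
open import Data.Integer.DivMod using (n%ℕd<d)
open import Data.Integer.Properties using (m-n≡m⊖n; ⊖-≥; ⊖-<)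
open import Data.Fin using (Fin; toℕ; fromℕ<)
open import Data.Fin.Properties using (toℕ<n; toℕ-fromℕ<; toℕ-injective)
open import Data.Product using (Σ; _×_; _,_; ∃-syntax)
open import Data.Sum using (_⊎_; inj₁; inj₂)
open import Relation.Binary.PropositionalEquality
open import Relation.Nullary using (¬_; yes; no)
open import Defs

module Modular (k : ℕ) .{{_ : NonZero k}} where
  open ≡-Reasoning

  infix 4 _≈_
  _≈_ : ℕ → ℕ → Set
  a ≈ b = a % k ≡ b % k

  %-≈ : ∀ a → a % k ≈ a
  %-≈ a = m%n%n≡m%n a k

  <-≈⇒≡ : ∀ {a b} → a < k → b < k → a ≈ b → a ≡ b
  <-≈⇒≡ a<k b<k a≈b = trans (sym (m<n⇒m%n≡m a<k)) (trans a≈b (m<n⇒m%n≡m b<k))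

  +-congʳ-≈ : ∀ {a b} c → a ≈ b → a + c ≈ b + c
  +-congʳ-≈ {a} {b} c a≈b = begin
    (a + c) % k             ≡⟨ %-distribˡ-+ a c k ⟩
    (a % k + c % k) % k     ≡⟨ cong (λ x → (x + c % k) % k) a≈b ⟩
    (b % k + c % k) % k     ≡⟨ %-distribˡ-+ b c k ⟨
    (b + c) % k             ∎

  +-congˡ-≈ : ∀ {a b} c → a ≈ b → c + a ≈ c + b
  +-congˡ-≈ {a} {b} c a≈b = subst₂ _≈_ (+-comm a c) (+-comm b c) (+-congʳ-≈ c a≈b)

  -- Subtracting c modulo k is adding c * (k − 1).
  +-cancelʳ-≈ : ∀ {a b} c → a + c ≈ b + c → a ≈ b
  +-cancelʳ-≈ {a} {b} c a+c≈b+c = begin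
    a % k                     ≡⟨ absorb a ⟨
    (a + c + c * pred k) % k  ≡⟨ +-congʳ-≈ (c * pred k) a+c≈b+c ⟩
    (b + c + c * pred k) % k  ≡⟨ absorb b ⟩
    b % k                     ∎
    where
    c+c*pred≡c*k : c + c * pred k ≡ c * k
    c+c*pred≡c*k = trans (sym (*-suc c (pred k))) (cong (c *_) (suc-pred k))

    absorb : ∀ x → x + c + c * pred k ≈ x
    absorb x = trans (cong (_% k) (trans (+-assoc x c _) (cong (x +_) c+c*pred≡c*k)))
                     ([m+kn]%n≡m%n x c k)

  +-∸-+-≈ : ∀ x {y} → y ≤ k → x + (k ∸ y) + y ≈ x
  +-∸-+-≈ x {y} y≤k = begin
    (x + (k ∸ y) + y) % k  ≡⟨ cong (_% k) (+-assoc x _ y) ⟩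
    (x + (k ∸ y + y)) % k  ≡⟨ cong (λ z → (x + z) % k) (m∸n+n≡m y≤k) ⟩
    (x + k) % k            ≡⟨ [m+n]%n≡m%n x k ⟩
    x % k                  ∎

  -[n]%ℕk≡k∸n : ∀ {n} → 0 < n → n < k → (- ⁺ n) %ℕ k ≡ k ∸ n
  -[n]%ℕk≡k∸n {suc n} _ n<k with suc n % k | m<n⇒m%n≡m n<k
  ... | .(suc n) | refl = refl

  [+x-+y]%ℕk≡[x+[k∸y]]%k : ∀ x {y} → y < k → (⁺ x - ⁺ y) %ℕ k ≡ (x + (k ∸ y)) % k
  [+x-+y]%ℕk≡[x+[k∸y]]%k x {y} y<k with y ≤? x
  ... | yes y≤x = begin
    (⁺ x - ⁺ y) %ℕ k   ≡⟨ cong (_%ℕ k) (trans (m-n≡m⊖n x y) (⊖-≥ y≤x)) ⟩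
    (x ∸ y) % k        ≡⟨ [m+n]%n≡m%n (x ∸ y) k ⟨
    (x ∸ y + k) % k    ≡⟨ cong (_% k) (+-∸-comm k y≤x) ⟨
    (x + k ∸ y) % k    ≡⟨ cong (_% k) (+-∸-assoc x (<⇒≤ y<k)) ⟩
    (x + (k ∸ y)) % k  ∎
  ... | no y≰x = begin
    (⁺ x - ⁺ y) %ℕ k       ≡⟨ cong (_%ℕ k) (trans (m-n≡m⊖n x y) (⊖-< x<y)) ⟩
    (- ⁺ (y ∸ x)) %ℕ k     ≡⟨ -[n]%ℕk≡k∸n (m<n⇒0<n∸m x<y) (≤-<-trans (m∸n≤m y x) y<k) ⟩
    k ∸ (y ∸ x)            ≡⟨ [m+n]∸[m+o]≡n∸o x k (y ∸ x) ⟨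
    x + k ∸ (x + (y ∸ x))  ≡⟨ cong (x + k ∸_) (m+[n∸m]≡n (<⇒≤ x<y)) ⟩
    x + k ∸ y              ≡⟨ +-∸-assoc x (<⇒≤ y<k) ⟩
    x + (k ∸ y)            ≡⟨ m<n⇒m%n≡m x+[k∸y]<k ⟨
    (x + (k ∸ y)) % k      ∎
    where
    x<y : x < y
    x<y = ≰⇒> y≰x

    x+[k∸y]<k : x + (k ∸ y) < k
    x+[k∸y]<k = subst (x + (k ∸ y) <_) (m+[n∸m]≡n (<⇒≤ y<k)) (+-monoˡ-< (k ∸ y) x<y)

  rotate : ℕ → Fin k → Fin k
  rotate s a = fromℕ< (m%n<n (toℕ a + s) k)

  toℕ-rotate-≈ : ∀ s a → toℕ (rotate s a) ≈ toℕ a + s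
  toℕ-rotate-≈ s a =
    trans (cong (_% k) (toℕ-fromℕ< (m%n<n (toℕ a + s) k))) (%-≈ (toℕ a + s))

  rotate-k : ∀ a → rotate k a ≡ a
  rotate-k a = toℕ-injective (begin
    toℕ (rotate k a)  ≡⟨ toℕ-fromℕ< (m%n<n (toℕ a + k) k) ⟩
    (toℕ a + k) % k   ≡⟨ [m+n]%n≡m%n (toℕ a) k ⟩
    toℕ a % k         ≡⟨ m<n⇒m%n≡m (toℕ<n a) ⟩
    toℕ a             ∎)

  toℕ-rotate-injective : ∀ s a b →
    toℕ (rotate s a) ≡ toℕ (rotate s b) → toℕ a ≡ toℕ b
  toℕ-rotate-injective s a b eq = <-≈⇒≡ (toℕ<n a) (toℕ<n b) (+-cancelʳ-≈ s (begin
    (toℕ a + s) % k           ≡⟨ toℕ-rotate-≈ s a ⟨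
    toℕ (rotate s a) % k      ≡⟨ cong (_% k) eq ⟩
    toℕ (rotate s b) % k      ≡⟨ toℕ-rotate-≈ s b ⟩
    (toℕ b + s) % k           ∎))

  -- The label relation of the wrap-around cross edges, in the encoding of CrossArc.
  IsSucc : ℕ → ℕ → Set
  IsSucc a b = (suc a < k × b ≡ suc a) ⊎ (suc a ≡ k × b ≡ 0)

  IsSucc⇒≈ : ∀ {a b} → IsSucc a b → b ≈ suc a
  IsSucc⇒≈ (inj₁ (_ , refl))    = refl
  IsSucc⇒≈ (inj₂ (1+a≡k , refl)) =
    trans (m<n⇒m%n≡m (>-nonZero⁻¹ k)) (sym (trans (cong (_% k) 1+a≡k) (n%n≡0 k)))

  ≈⇒IsSucc : ∀ {a b} → a < k → b < k → b ≈ suc a → IsSucc a b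
  ≈⇒IsSucc {a} {b} a<k b<k b≈1+a with m≤n⇒m<n∨m≡n a<k
  ... | inj₁ 1+a<k = inj₁ (1+a<k , <-≈⇒≡ b<k 1+a<k b≈1+a)
  ... | inj₂ 1+a≡k = inj₂ (1+a≡k , (begin
    b          ≡⟨ m<n⇒m%n≡m b<k ⟨
    b % k      ≡⟨ b≈1+a ⟩
    suc a % k  ≡⟨ cong (_% k) 1+a≡k ⟩
    k % k      ≡⟨ n%n≡0 k ⟩
    0          ∎))

  IsSucc-rotate⁻ : ∀ s a b →
    IsSucc (toℕ (rotate s a)) (toℕ (rotate s b)) → IsSucc (toℕ a) (toℕ b)
  IsSucc-rotate⁻ s a b succ = ≈⇒IsSucc (toℕ<n a) (toℕ<n b) (+-cancelʳ-≈ s (begin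
    (toℕ b + s) % k                ≡⟨ toℕ-rotate-≈ s b ⟨
    toℕ (rotate s b) % k           ≡⟨ IsSucc⇒≈ succ ⟩
    suc (toℕ (rotate s a)) % k     ≡⟨ +-congˡ-≈ 1 (toℕ-rotate-≈ s a) ⟩
    (suc (toℕ a) + s) % k          ∎))

  diff : Fin k → Fin k → ℕ
  diff a b = (⁺ toℕ a - ⁺ toℕ b) %ℕ k

  diff-rotate : ∀ {j} → j < k → ∀ a → diff a (rotate (k ∸ j) a) ≡ j
  diff-rotate {j} j<k a = begin
    diff a b                   ≡⟨ [+x-+y]%ℕk≡[x+[k∸y]]%k (toℕ a) (toℕ<n b) ⟩
    (toℕ a + (k ∸ toℕ b)) % k  ≡⟨ +-cancelʳ-≈ (toℕ b) (begin
      (toℕ a + (k ∸ toℕ b) + toℕ b) % k  ≡⟨ +-∸-+-≈ (toℕ a) (<⇒≤ (toℕ<n b)) ⟩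
      toℕ a % k                          ≡⟨ +-∸-+-≈ (toℕ a) (<⇒≤ j<k) ⟨
      (toℕ a + (k ∸ j) + j) % k          ≡⟨ cong (_% k) (+-comm _ j) ⟩
      (j + (toℕ a + (k ∸ j))) % k        ≡⟨ +-congˡ-≈ j (toℕ-rotate-≈ (k ∸ j) a) ⟨
      (j + toℕ b) % k                    ∎) ⟩
    j % k                      ≡⟨ m<n⇒m%n≡m j<k ⟩
    j                          ∎
    where
    b : Fin k
    b = rotate (k ∸ j) a

  rotate-diff : ∀ a b → b ≡ rotate (k ∸ diff a b) a
  rotate-diff a b =
    toℕ-injective (<-≈⇒≡ (toℕ<n b) (toℕ<n (rotate (k ∸ d) a)) (+-cancelʳ-≈ d (begin
    (toℕ b + d) % k                      ≡⟨ +-congˡ-≈ (toℕ b) d≈ ⟩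
    (toℕ b + (toℕ a + (k ∸ toℕ b))) % k  ≡⟨ cong (_% k) (+-comm (toℕ b) _) ⟩
    (toℕ a + (k ∸ toℕ b) + toℕ b) % k    ≡⟨ +-∸-+-≈ (toℕ a) (<⇒≤ (toℕ<n b)) ⟩
    toℕ a % k                            ≡⟨ +-∸-+-≈ (toℕ a) (<⇒≤ d<k) ⟨
    (toℕ a + (k ∸ d) + d) % k            ≡⟨ +-congʳ-≈ d (toℕ-rotate-≈ (k ∸ d) a) ⟨
    (toℕ (rotate (k ∸ d) a) + d) % k     ∎)))
    where
    d : ℕ
    d = diff a b

    d<k : d < k
    d<k = n%ℕd<d (⁺ toℕ a - ⁺ toℕ b) k

    d≈ : d ≈ toℕ a + (k ∸ toℕ b)
    d≈ = trans (cong (_% k) ([+x-+y]%ℕk≡[x+[k∸y]]%k (toℕ a) (toℕ<n b))) (%-≈ _)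

  diff-self : ∀ a → diff a a ≡ 0
  diff-self a = subst (λ b → diff a b ≡ 0) (rotate-k a) (diff-rotate {0} (>-nonZero⁻¹ k) a)

module Twister (m k : ℕ) .{{_ : NonZero k}} where
  open Modular k

  CrossArc-rotate⁻ : ∀ s {p q} a b →
    CrossArc m k (p , rotate s a) (q , rotate s b) → CrossArc m k (p , a) (q , b)
  CrossArc-rotate⁻ s a b (inj₁ (step , same)) =
    inj₁ (step , toℕ-rotate-injective s a b same)
  CrossArc-rotate⁻ s a b (inj₂ (wrap , first , succ)) =
    inj₂ (wrap , first , IsSucc-rotate⁻ s a b succ)

  Adj-rotate⁻ : ∀ s {p q} a b →
    Adj m k (p , rotate s a) (q , rotate s b) → Adj m k (p , a) (q , b)
  Adj-rotate⁻ s a b (inj₁ (p≡q , ra≢rb)) =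
    inj₁ (p≡q , λ a≡b → ra≢rb (cong (rotate s) a≡b))
  Adj-rotate⁻ s a b (inj₂ (inj₁ arc))    = inj₂ (inj₁ (CrossArc-rotate⁻ s a b arc))
  Adj-rotate⁻ s a b (inj₂ (inj₂ arc))    = inj₂ (inj₂ (CrossArc-rotate⁻ s b a arc))

  rotateColoring : ℕ → HColoring m k → HColoring m k
  rotateColoring s I = hcol (λ p → rotate s (col I p))
    (λ p q adj → indep I p q (Adj-rotate⁻ s (col I p) (col I q) adj))

  rotateColoring-Equiv : ∀ {j} → j < k → ∀ I → Equiv k I (rotateColoring (k ∸ j) I)
  rotateColoring-Equiv j<k I = _ , j<k , λ p → diff-rotate j<k (col I p)

  Equiv⇒rotateColoring : ∀ I J {j} → (∀ p → diff (col I p) (col J p) ≡ j) →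
    SameColoring J (rotateColoring (k ∸ j) I)
  Equiv⇒rotateColoring I J eq p =
    trans (rotate-diff (col I p) (col J p)) (cong (λ d → rotate (k ∸ d) (col I p)) (eq p))

  u₁ : Fin (len m)
  u₁ = fromℕ< (<-≤-trans z<s (m≤n+m 2 (2 * m)))

  equivClass : (I : HColoring m k) →
    Σ (Fin k → HColoring m k) λ f →
      (∀ l → Equiv k I (f l))
      × (∀ l l′ → SameColoring (f l) (f l′) → l ≡ l′)
      × (∀ J → Equiv k I J → ∃[ l ] SameColoring J (f l))
  equivClass I = f , (λ l → rotateColoring-Equiv (toℕ<n l) I) , injective , complete
    where
    f : Fin k → HColoring m k
    f l = rotateColoring (k ∸ toℕ l) I

    label : ∀ l → diff (col I u₁) (col (f l) u₁) ≡ toℕ l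
    label l = diff-rotate (toℕ<n l) (col I u₁)

    injective : ∀ l l′ → SameColoring (f l) (f l′) → l ≡ l′
    injective l l′ same =
      toℕ-injective (trans (sym (label l)) (trans (cong (diff (col I u₁)) (same u₁)) (label l′)))

    complete : ∀ J → Equiv k I J → ∃[ l ] SameColoring J (f l)
    complete J (j , j<k , eq) = fromℕ< j<k , λ p →
      trans (Equiv⇒rotateColoring I J eq p)
            (cong (λ i → rotate (k ∸ i) (col I p)) (sym (toℕ-fromℕ< j<k)))

  Equiv-¬SameColoring⇒col≢ : ∀ I₁ I₂ → Equiv k I₁ I₂ → ¬ SameColoring I₁ I₂ →
    ∀ p → col I₁ p ≢ col I₂ p
  Equiv-¬SameColoring⇒col≢ I₁ I₂ (j , _ , eq) I₁≠I₂ p c₁≡c₂ = I₁≠I₂ λ q → sym (begin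
    col I₂ q                   ≡⟨ Equiv⇒rotateColoring I₁ I₂ eq q ⟩
    rotate (k ∸ j) (col I₁ q)  ≡⟨ cong (λ i → rotate (k ∸ i) (col I₁ q)) j≡0 ⟩
    rotate k (col I₁ q)        ≡⟨ rotate-k (col I₁ q) ⟩
    col I₁ q                   ∎)
    where
    open ≡-Reasoning
    j≡0 : j ≡ 0
    j≡0 = trans (sym (eq p)) (trans (cong (diff (col I₁ p)) (sym c₁≡c₂)) (diff-self (col I₁ p)))

lemma21 : (m k : ℕ) .{{_ : NonZero k}} → 3 ≤ k →
    ((I : HColoring m k) →
      Σ (Fin k → HColoring m k) λ f →
        (∀ l → Equiv k I (f l))
        × (∀ l l′ → SameColoring (f l) (f l′) → l ≡ l′)
        × (∀ J → Equiv k I J → ∃[ l ] SameColoring J (f l)))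
    × ((I₁ I₂ : HColoring m k) → Equiv k I₁ I₂ → ¬ SameColoring I₁ I₂ →
        ∀ p → col I₁ p ≢ col I₂ p)
lemma21 m k _ = equivClass , Equiv-¬SameColoring⇒col≢
  where open Twister m k
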